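{- Let $\mathcal U$ be a unification algorithm satisfying renaming compatibility (for every renaming $\rho$ and every unifiable equation $E$, $\mathcal U(\rho(E))=\rho(\mathcal U(E))$) and yielding relevant mgus. Let $$G \xrightarrow{\mathcal K_1:\sigma_1} G_1 \xrightarrow{\mathcal K_2:\sigma_2}\cdots\xrightarrow{\mathcal K_n:\sigma_n} G_n,\qquad G' \xrightarrow{\mathcal K'_1:\sigma'_1} G'_1 \xrightarrow{\mathcal K'_2:\sigma'_2}\cdots\xrightarrow{\mathcal K'_n:\sigma'_n} G'_n$$ be two similar SLD-derivations (computed with $\mathcal U$). Then finite similar SLD-derivations starting from variant queries have variant partial answers, and the variance depends only on the starting queries and the input clauses. Precisely: put $\alpha:=\mathrm{pren}(G,G')$, $\lambda_i:=\mathrm{pren}(\mathcal K_i,\mathcal K'_i)$ and $\beta_i:=\alpha\oplus\lambda_1\oplus\cdots\oplus\lambda_i$. Then for every $i=1,\dots,n$: $$G'_i=\beta_i(G_i),\qquad \sigma'_i=\beta_i(\sigma_i),\qquad \sigma'_i\circ\cdots\circ\sigma'_1=\beta_i(\sigma_i\circ\cdots\circ\sigma_1).$$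
   Context: Terms are built from a countably infinite set $V$ of variables and function symbols; $\mathrm{vars}(t)$ is the set of variables of $t$. A substitution is a map $\theta$ from variables to terms with finite active domain $\mathrm{Dom}(\theta)=\{x:\theta(x)\neq x\}$, extended homomorphically to terms; $(\theta\circ\sigma)(x)=\theta(\sigma(x))$; $\mathrm{vars}(\theta)=\mathrm{Dom}(\theta)\cup\mathrm{vars}(\theta(\mathrm{Dom}(\theta)))$. A renaming is a bijective substitution mapping variables to variables. Relaxed core: a substitution may be given together with a fixed finite set $C^+(\theta)\supseteq\mathrm{Dom}(\theta)$ (its relaxed core, possibly containing passive variables $x$ with $\theta(x)=x$); $R^+(\theta)=\theta(C^+(\theta))$. A prenaming is a substitution $\alpha$ mapping variables to variables, together with a finite relaxed core $C^+(\alpha)\supseteq\mathrm{Dom}(\alpha)$ on which $\alpha$ is injective. If $\alpha,\beta$ are prenamings with $C^+(\alpha)\cap C^+(\beta)=\emptyset$ and $R^+(\alpha)\cap R^+(\beta)=\emptyset$, their sum $\alpha\oplus\beta$ is the prenaming with relaxed core $C^+(\alpha)\cup C^+(\beta)$ that agrees with $\alpha$ on $C^+(\alpha)$, with $\beta$ on $C^+(\beta)$, and is the identity elsewhere. For terms $s,t$ such that $t$ is obtained from $s$ by an injective replacement of variables by variables, $\mathrm{pren}(s,t)$ is the unique prenaming $\alpha$ with $C^+(\alpha)=\mathrm{vars}(s)$ and $\alpha(s)=t$ (so $R^+(\alpha)=\mathrm{vars}(t)$). $\mathrm{noninj}(\alpha)=R^+(\alpha)\setminus C^+(\alpha)$,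 $\mathrm{indom}(\alpha)=V\setminus\mathrm{noninj}(\alpha)$; $\alpha$ is safe for a term (or substitution) $t$ if $\mathrm{vars}(t)\subseteq\mathrm{indom}(\alpha)$; $s$ and $t$ are variants if $s=\alpha(t)$ for a prenaming $\alpha$ safe for $t$. For a substitution $\sigma$ and a prenaming $\alpha$ safe for $\sigma$, the substitution variant is $\alpha(\sigma):=\{\alpha(x)/\alpha(\sigma(x)) : x\in\mathrm{Dom}(\sigma)\}$ (the substitution mapping each $\alpha(x)$, $x\in\mathrm{Dom}(\sigma)$, to $\alpha(\sigma(x))$ and identity elsewhere). SLD-derivations: a goal is a sequence of atoms. An SLD step $G\xrightarrow{\mathcal K:\sigma}H$ with $G=(M,A,N)$ selects atom $A$, uses an input clause $\mathcal K= A_1\leftarrow B_1$ which is a variant of a program clause whose variables are disjoint from all variables of the derivation so far (standardization apart), $\sigma=\mathcal U(A,A_1)$ is the mgu computed by the fixed algorithm $\mathcal U$, and $H=\sigma(M,B_1,N)$. An mgu $\sigma$ of $A,A_1$ is relevant if $\mathrm{vars}(\sigma)\subseteq\mathrm{vars}(A)\cup\mathrm{vars}(A_1)$. The partial answer at step $i$ is $\sigma_i\circ\cdots\circ\sigma_1$. Two SLD-derivations of the same length are similar if their initial goals $G,G'$ are variants and at each step atoms in the same position are selected and the input clauses $\mathcal K_i,\mathcal K'_i$ are variants. -}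

module Defs where

open import Data.Nat using (ℕ; zero; suc; _≤_; _<_; _≟_)
open import Data.List using (List; []; _∷_; _++_; concatMap; length)
import Data.List as L
open import Data.List.Membership.Propositional using (_∈_; _∉_)
open import Data.List.Membership.Propositional.Properties using (∈-++⁺ˡ; ∈-++⁺ʳ)
import Data.List.Membership.DecPropositional as DecMem
open import Data.Maybe using (Maybe; just; nothing)
open import Data.Product using (Σ; ∃; _×_; _,_)
open import Data.Sum using (_⊎_)
open import Data.Bool using (if_then_else_)
open import Relation.Nullary using (¬_; does)
open import Relation.Binary.PropositionalEquality using (_≡_; _≢_; refl)
open import Function.Bundles using (_⇔_)

open DecMem _≟_ using (_∈?_)

module Syntax (F Pr : Set) where

  data Term : Set where
    var : ℕ → Term
    fn  : F → List Term → Term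

  record Atom : Set where
    constructor _⟨_⟩
    field
      pred : Pr
      args : List Term

  Goal : Set
  Goal = List Atom

  record Clause : Set where
    constructor _⇐_
    field
      head : Atom
      body : List Atom
  open Clause public

  mutual
    sub : (ℕ → Term) → Term → Term
    sub s (var x)   = s x
    sub s (fn f ts) = fn f (subs s ts)

    subs : (ℕ → Term) → List Term → List Term
    subs s []       = []
    subs s (t ∷ ts) = sub s t ∷ subs s ts

  mutual
    varsT : Term → List ℕ
    varsT (var x)   = x ∷ []
    varsT (fn f ts) = varsTs ts

    varsTs : List Term → List ℕ
    varsTs []       = []
    varsTs (t ∷ ts) = varsT t ++ varsTs ts

  subA : (ℕ → Term) → Atom → Atom
  subA s (p ⟨ ts ⟩) = p ⟨ subs s ts ⟩

  varsA : Atom → List ℕ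
  varsA (p ⟨ ts ⟩) = varsTs ts

  subG : (ℕ → Term) → Goal → Goal
  subG s G = L.map (subA s) G

  varsG : Goal → List ℕ
  varsG G = concatMap varsA G

  subC : (ℕ → Term) → Clause → Clause
  subC s (h ⇐ b) = subA s h ⇐ subG s b

  varsC : Clause → List ℕ
  varsC (h ⇐ b) = varsA h ++ varsG b

  -- Substitutions: maps V → Term whose active domain is finite
  -- (contained in the finite list `supp`).
  record Subst : Set where
    field
      app     : ℕ → Term
      supp    : List ℕ
      outside : ∀ x → x ∉ supp → app x ≡ var x
  open Subst public

  _∈Dom_ : ℕ → Subst → Set
  x ∈Dom θ = app θ x ≢ var x

  _∈VarsS_ : ℕ → Subst → Set
  x ∈VarsS θ = x ∈Dom θ ⊎ ∃ λ y → y ∈Dom θ × x ∈ varsT (app θ y)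

  idS : Subst
  idS = record { app = var ; supp = [] ; outside = λ x _ → refl }

  _∘S_ : Subst → Subst → Subst
  θ ∘S σ = record
    { app = λ x → sub (app θ) (app σ x)
    ; supp = supp σ ++ supp θ
    ; outside = out }
    where
    out : ∀ x → x ∉ supp σ ++ supp θ → sub (app θ) (app σ x) ≡ var x
    out x x∉ rewrite outside σ x (λ m → x∉ (∈-++⁺ˡ m)) =
      outside θ x (λ m → x∉ (∈-++⁺ʳ (supp σ) m))

  -- Prenamings: a relaxed core C⁺ (finite list) and a map V → V.
  record PreRen : Set where
    constructor mkPR
    field
      core : List ℕ
      fun  : ℕ → ℕ
  open PreRen public

  ren : (ℕ → ℕ) → ℕ → Term
  ren f x = var (f x)

  IsPrenaming : PreRen → Set
  IsPrenaming α =
    (∀ x → x ∉ core α → fun α x ≡ x) ×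
    (∀ x y → x ∈ core α → y ∈ core α → fun α x ≡ fun α y → x ≡ y)

  rng : PreRen → List ℕ
  rng α = L.map (fun α) (core α)

  _∈noninj_ : ℕ → PreRen → Set
  x ∈noninj α = x ∈ rng α × x ∉ core α

  SafeFor : PreRen → List ℕ → Set
  SafeFor α xs = ∀ x → x ∈ xs → ¬ (x ∈noninj α)

  VariantG : Goal → Goal → Set
  VariantG s t = Σ PreRen λ α → IsPrenaming α × SafeFor α (varsG t) × s ≡ subG (ren (fun α)) t

  VariantC : Clause → Clause → Set
  VariantC s t = Σ PreRen λ α → IsPrenaming α × SafeFor α (varsC t) × s ≡ subC (ren (fun α)) t

  IsPrenG : PreRen → Goal → Goal → Set
  IsPrenG α s t = IsPrenaming α × (∀ x → (x ∈ core α) ⇔ (x ∈ varsG s)) × t ≡ subG (ren (fun α)) s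

  IsPrenC : PreRen → Clause → Clause → Set
  IsPrenC α s t = IsPrenaming α × (∀ x → (x ∈ core α) ⇔ (x ∈ varsC s)) × t ≡ subC (ren (fun α)) s

  _⊕_ : PreRen → PreRen → PreRen
  α ⊕ β = mkPR (core α ++ core β)
               (λ x → if does (x ∈? core α) then fun α x else fun β x)

  IsSubstVariant : (ℕ → ℕ) → Subst → Subst → Set
  IsSubstVariant f σ τ =
    (∀ x → x ∈Dom σ → app τ (f x) ≡ sub (ren f) (app σ x)) ×
    (∀ y → (∀ x → x ∈Dom σ → f x ≢ y) → app τ y ≡ var y)

  record Renaming : Set where
    field
      rfun     : ℕ → ℕ
      rsupp    : List ℕ
      routside : ∀ x → x ∉ rsupp → rfun x ≡ x
      rinj     : ∀ x y → rfun x ≡ rfun y → x ≡ y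
      rsurj    : ∀ y → ∃ λ x → rfun x ≡ y
  open Renaming public

  Unifier : Subst → Atom → Atom → Set
  Unifier θ A B = subA (app θ) A ≡ subA (app θ) B

  Unifiable : Atom → Atom → Set
  Unifiable A B = Σ Subst λ θ → Unifier θ A B

  IsMgu : Subst → Atom → Atom → Set
  IsMgu σ A B = Unifier σ A B ×
    (∀ θ → Unifier θ A B → Σ Subst λ δ → ∀ x → app θ x ≡ sub (app δ) (app σ x))

  UnifAlg : Set
  UnifAlg = Atom → Atom → Maybe Subst

  IsUnificationAlgorithm : UnifAlg → Set
  IsUnificationAlgorithm U =
    (∀ A B σ → U A B ≡ just σ → IsMgu σ A B) ×
    (∀ A B → U A B ≡ nothing → ¬ Unifiable A B)

  RenamingCompatible : UnifAlg → Set
  RenamingCompatible U = ∀ (ρ : Renaming) A B → Unifiable A B → ∀ σ → U A B ≡ just σ →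
    Σ Subst λ τ → U (subA (ren (rfun ρ)) A) (subA (ren (rfun ρ)) B) ≡ just τ
                × IsSubstVariant (rfun ρ) σ τ

  RelevantMgus : UnifAlg → Set
  RelevantMgus U = ∀ A B σ → U A B ≡ just σ → ∀ x → x ∈VarsS σ → x ∈ varsA A ++ varsA B

  -- One SLD step G --K:σ--> H of program P, selecting the atom at
  -- (0-based) position k.
  record SLDStep (P : List Clause) (U : UnifAlg) (G : Goal) (k : ℕ)
                 (K : Clause) (σ : Subst) (H : Goal) : Set where
    field
      M N     : Goal
      A       : Atom
      split   : G ≡ M ++ A ∷ N
      posn    : length M ≡ k
      input   : Σ Clause λ c → c ∈ P × VariantC K c
      mgu     : U A (head K) ≡ just σ
      result  : H ≡ subG (app σ) (M ++ body K ++ N)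

  -- An SLD-derivation of length n:
  -- G 0 --K 1:σ 1--> G 1 --> ... --K n:σ n--> G n, selected positions pos i,
  -- with standardization apart of the input clauses.
  record SLDDerivation (P : List Clause) (U : UnifAlg) (n : ℕ) (G : ℕ → Goal)
                       (pos : ℕ → ℕ) (K : ℕ → Clause) (σ : ℕ → Subst) : Set where
    field
      steps : ∀ i → i < n → SLDStep P U (G i) (pos (suc i)) (K (suc i)) (σ (suc i)) (G (suc i))
      apart : ∀ i → i < n → ∀ x → x ∈ varsC (K (suc i)) →
                (∀ j → j ≤ i → x ∉ varsG (G j)) ×
                (∀ j → 1 ≤ j → j ≤ i → (x ∉ varsC (K j)) × ¬ (x ∈VarsS σ j))

  Similar : ℕ → (ℕ → Goal) → (ℕ → ℕ) → (ℕ → Clause) →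
            (ℕ → Goal) → (ℕ → ℕ) → (ℕ → Clause) → Set
  Similar n G pos K G' pos' K' =
    VariantG (G' 0) (G 0) ×
    (∀ i → 1 ≤ i → i ≤ n → (pos i ≡ pos' i) × VariantC (K' i) (K i))

  βsum : PreRen → (ℕ → PreRen) → ℕ → PreRen
  βsum α lam zero    = α
  βsum α lam (suc i) = βsum α lam i ⊕ lam (suc i)

  answer : (ℕ → Subst) → ℕ → Subst
  answer σ zero    = idS
  answer σ (suc i) = σ (suc i) ∘S answer σ i

module Submission where

-- Write f i and C i for the map and the relaxed core of β i = α ⊕ λ₁ ⊕ ... ⊕ λ i.
-- The central notion is `Tracks f C θ θ'`: θ' is the f-variant of θ, and all
-- variables relevant to θ live in C (its domain, and the variables of its
-- bindings on C).  Tracking is preserved by the identity, by composition, and by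
-- enlarging the core along an injective extension of f.  By renaming
-- compatibility and relevance, an mgu of an equation renamed by f is tracked
-- by the mgu of the original equation, as soon as f is injective on a core C
-- containing the variables of the equation (an injective map on a finite set
-- extends to a renaming, built from transpositions).
--
-- For the derivations, standardization apart makes the input clauses fresh in
-- both derivations, so β i is injective on C i.  By induction on i we maintain:
-- G' i = β i (G i), vars (G i) ⊆ C i, and the partial answers are tracked by
-- β i.  The induction step decomposes both goals at the selected atom, applies
-- the mgu lemma, and composes.

open import Defs
open import Data.Nat using (ℕ; zero; suc; _≤_; _≟_; z≤n; s≤s)
open import Data.Nat.Properties using (<⇒≤; m≤n⇒m≤1+n; ≤-refl; suc-injective)
open import Data.List using (List; []; _∷_; _++_; length)
open import Data.List.Properties using (map-++; length-map; ∷-injective; concatMap-++)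
open import Data.List.Membership.Propositional using (_∈_; _∉_)
open import Data.List.Membership.Propositional.Properties using (∈-++⁺ˡ; ∈-++⁺ʳ; ∈-++⁻)
open import Data.List.Relation.Binary.Subset.Propositional using (_⊆_)
open import Data.List.Relation.Binary.Subset.Propositional.Properties using (⊆-trans)
open import Data.List.Relation.Unary.Any using (here; there)
import Data.List.Membership.DecPropositional as DecMem
open import Data.Maybe using (just)
open import Data.Maybe.Properties using (just-injective)
open import Data.Product using (Σ; ∃; _×_; _,_; proj₁; proj₂)
open import Data.Sum using (_⊎_; inj₁; inj₂)
open import Data.Empty using (⊥-elim)
open import Relation.Nullary using (¬_; Dec; yes; no)
open import Relation.Binary.PropositionalEquality
  using (_≡_; _≢_; refl; sym; trans; cong; cong₂; subst; subst₂; module ≡-Reasoning)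
open import Function.Bundles using (_⇔_; Equivalence)

open DecMem _≟_ using (_∈?_)

++-∷-injective : ∀ {A : Set} (M₁ M₂ : List A) {a b : A} {N₁ N₂ : List A} →
  length M₁ ≡ length M₂ → M₁ ++ a ∷ N₁ ≡ M₂ ++ b ∷ N₂ → M₁ ≡ M₂ × a ≡ b × N₁ ≡ N₂
++-∷-injective []       []       _   refl = refl , refl , refl
++-∷-injective (x ∷ M₁) (y ∷ M₂) len eq
  with ∷-injective eq
... | x≡y , rest with ++-∷-injective M₁ M₂ (suc-injective len) rest
... | M₁≡M₂ , a≡b , N₁≡N₂ = cong₂ _∷_ x≡y M₁≡M₂ , a≡b , N₁≡N₂

transpose : ℕ → ℕ → ℕ → ℕ
transpose a b z with z ≟ a
... | yes _ = b
... | no _ with z ≟ b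
... | yes _ = a
... | no _ = z

transpose-a : ∀ a b → transpose a b a ≡ b
transpose-a a b with a ≟ a
... | yes _  = refl
... | no a≢a = ⊥-elim (a≢a refl)

transpose-b : ∀ a b → transpose a b b ≡ a
transpose-b a b with b ≟ a
... | yes b≡a = b≡a
... | no _ with b ≟ b
... | yes _  = refl
... | no b≢b = ⊥-elim (b≢b refl)

transpose-other : ∀ a b z → z ≢ a → z ≢ b → transpose a b z ≡ z
transpose-other a b z z≢a z≢b with z ≟ a
... | yes z≡a = ⊥-elim (z≢a z≡a)
... | no _ with z ≟ b
... | yes z≡b = ⊥-elim (z≢b z≡b)
... | no _ = refl

transpose-involutive : ∀ a b z → transpose a b (transpose a b z) ≡ z
transpose-involutive a b z with z ≟ a
... | yes refl = transpose-b a b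
... | no z≢a with z ≟ b
... | yes refl = transpose-a a b
... | no z≢b = transpose-other a b z z≢a z≢b

InjectiveOn : (ℕ → ℕ) → List ℕ → Set
InjectiveOn f xs = ∀ x y → x ∈ xs → y ∈ xs → f x ≡ f y → x ≡ y

OutsideImage : (ℕ → ℕ) → List ℕ → ℕ → Set
OutsideImage f xs y = ∀ x → x ∈ xs → f x ≢ y

module Development (F Pr : Set) where
  open Syntax F Pr

  transpositionR : ℕ → ℕ → Renaming
  transpositionR a b = record
    { rfun     = transpose a b
    ; rsupp    = a ∷ b ∷ []
    ; routside = λ x x∉ → transpose-other a b x (λ e → x∉ (here e)) (λ e → x∉ (there (here e)))
    ; rinj     = λ x y e → trans (sym (transpose-involutive a b x))
                             (trans (cong (transpose a b) e) (transpose-involutive a b y))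
    ; rsurj    = λ y → transpose a b y , transpose-involutive a b y }

  idR : Renaming
  idR = record { rfun = λ x → x ; rsupp = [] ; routside = λ _ _ → refl
               ; rinj = λ _ _ e → e ; rsurj = λ y → y , refl }

  _∘R_ : Renaming → Renaming → Renaming
  ρ₂ ∘R ρ₁ = record
    { rfun     = λ x → rfun ρ₂ (rfun ρ₁ x)
    ; rsupp    = rsupp ρ₁ ++ rsupp ρ₂
    ; routside = λ x x∉ → trans (cong (rfun ρ₂) (routside ρ₁ x (λ m → x∉ (∈-++⁺ˡ m))))
                                (routside ρ₂ x (λ m → x∉ (∈-++⁺ʳ (rsupp ρ₁) m)))
    ; rinj     = λ x y e → rinj ρ₁ x y (rinj ρ₂ _ _ e)
    ; rsurj    = λ y → let (z , ρ₂z≡y) = rsurj ρ₂ y ; (w , ρ₁w≡z) = rsurj ρ₁ z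
                       in w , trans (cong (rfun ρ₂) ρ₁w≡z) ρ₂z≡y }

  -- A map injective on a finite set agrees there with some renaming: add the
  -- elements one at a time, correcting the value of the new one by a
  -- transposition that cannot disturb the earlier ones.
  extend-to-renaming : (xs : List ℕ) (f : ℕ → ℕ) → InjectiveOn f xs →
    Σ Renaming λ ρ → ∀ x → x ∈ xs → rfun ρ x ≡ f x
  extend-to-renaming [] f inj = idR , λ _ ()
  extend-to-renaming (x ∷ xs) f inj
    with extend-to-renaming xs f (λ a b a∈ b∈ → inj a b (there a∈) (there b∈)) | x ∈? xs
  ... | ρ , agree | yes x∈xs = ρ , λ { z (here refl) → agree z x∈xs ; z (there z∈) → agree z z∈ }
  ... | ρ , agree | no x∉xs  = transpositionR (rfun ρ x) (f x) ∘R ρ , agree′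
    where
    agree′ : ∀ z → z ∈ x ∷ xs → transpose (rfun ρ x) (f x) (rfun ρ z) ≡ f z
    agree′ z (here refl) = transpose-a (rfun ρ z) (f z)
    agree′ z (there z∈) = trans (transpose-other _ _ _ ρz≢ρx fz≢fx) (agree z z∈)
      where
      ρz≢ρx : rfun ρ z ≢ rfun ρ x
      ρz≢ρx e = x∉xs (subst (_∈ xs) (rinj ρ z x e) z∈)
      fz≢fx : rfun ρ z ≢ f x
      fz≢fx e = x∉xs (subst (_∈ xs) (inj z x (there z∈) (here refl) (trans (sym (agree z z∈)) e)) z∈)

  isVar? : (t : Term) (y : ℕ) → Dec (t ≡ var y)
  isVar? (var z) y with z ≟ y
  ... | yes refl = yes refl
  ... | no z≢y   = no λ { refl → z≢y refl }
  isVar? (fn _ _) y = no λ ()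

  mutual
    sub-cong : ∀ {f g} t → (∀ x → x ∈ varsT t → f x ≡ g x) → sub f t ≡ sub g t
    sub-cong (var x)   h = h x (here refl)
    sub-cong (fn c ts) h = cong (fn c) (subs-cong ts h)

    subs-cong : ∀ {f g} ts → (∀ x → x ∈ varsTs ts → f x ≡ g x) → subs f ts ≡ subs g ts
    subs-cong []       h = refl
    subs-cong (t ∷ ts) h = cong₂ _∷_ (sub-cong t (λ x m → h x (∈-++⁺ˡ m)))
                                     (subs-cong ts (λ x m → h x (∈-++⁺ʳ (varsT t) m)))

  subA-cong : ∀ {f g} A → (∀ x → x ∈ varsA A → f x ≡ g x) → subA f A ≡ subA g A
  subA-cong (p ⟨ ts ⟩) h = cong (p ⟨_⟩) (subs-cong ts h)

  subG-cong : ∀ {f g} G → (∀ x → x ∈ varsG G → f x ≡ g x) → subG f G ≡ subG g G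
  subG-cong []      h = refl
  subG-cong (A ∷ G) h = cong₂ _∷_ (subA-cong A (λ x m → h x (∈-++⁺ˡ m)))
                                  (subG-cong G (λ x m → h x (∈-++⁺ʳ (varsA A) m)))

  subC-cong : ∀ {f g} c → (∀ x → x ∈ varsC c → f x ≡ g x) → subC f c ≡ subC g c
  subC-cong (h ⇐ b) e = cong₂ _⇐_ (subA-cong h (λ x m → e x (∈-++⁺ˡ m)))
                                  (subG-cong b (λ x m → e x (∈-++⁺ʳ (varsA h) m)))

  mutual
    sub-comp : ∀ f g t → sub f (sub g t) ≡ sub (λ x → sub f (g x)) t
    sub-comp f g (var x)   = refl
    sub-comp f g (fn c ts) = cong (fn c) (subs-comp f g ts)

    subs-comp : ∀ f g ts → subs f (subs g ts) ≡ subs (λ x → sub f (g x)) ts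
    subs-comp f g []       = refl
    subs-comp f g (t ∷ ts) = cong₂ _∷_ (sub-comp f g t) (subs-comp f g ts)

  subA-comp : ∀ f g A → subA f (subA g A) ≡ subA (λ x → sub f (g x)) A
  subA-comp f g (p ⟨ ts ⟩) = cong (p ⟨_⟩) (subs-comp f g ts)

  subG-comp : ∀ f g G → subG f (subG g G) ≡ subG (λ x → sub f (g x)) G
  subG-comp f g []      = refl
  subG-comp f g (A ∷ G) = cong₂ _∷_ (subA-comp f g A) (subG-comp f g G)

  mutual
    vars-sub⁻ : ∀ s t x → x ∈ varsT (sub s t) → ∃ λ z → z ∈ varsT t × x ∈ varsT (s z)
    vars-sub⁻ s (var z)   x m = z , here refl , m
    vars-sub⁻ s (fn c ts) x m = vars-subs⁻ s ts x m

    vars-subs⁻ : ∀ s ts x → x ∈ varsTs (subs s ts) → ∃ λ z → z ∈ varsTs ts × x ∈ varsT (s z)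
    vars-subs⁻ s (t ∷ ts) x m with ∈-++⁻ (varsT (sub s t)) m
    ... | inj₁ m₁ = let (z , z∈ , x∈) = vars-sub⁻ s t x m₁ in z , ∈-++⁺ˡ z∈ , x∈
    ... | inj₂ m₂ = let (z , z∈ , x∈) = vars-subs⁻ s ts x m₂ in z , ∈-++⁺ʳ (varsT t) z∈ , x∈

  vars-subA⁻ : ∀ s A x → x ∈ varsA (subA s A) → ∃ λ z → z ∈ varsA A × x ∈ varsT (s z)
  vars-subA⁻ s (p ⟨ ts ⟩) = vars-subs⁻ s ts

  vars-subG⁻ : ∀ s G x → x ∈ varsG (subG s G) → ∃ λ z → z ∈ varsG G × x ∈ varsT (s z)
  vars-subG⁻ s (A ∷ G) x m with ∈-++⁻ (varsA (subA s A)) m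
  ... | inj₁ m₁ = let (z , z∈ , x∈) = vars-subA⁻ s A x m₁ in z , ∈-++⁺ˡ z∈ , x∈
  ... | inj₂ m₂ = let (z , z∈ , x∈) = vars-subG⁻ s G x m₂ in z , ∈-++⁺ʳ (varsA A) z∈ , x∈

  mutual
    vars-sub⁺ : ∀ s t x z → z ∈ varsT t → x ∈ varsT (s z) → x ∈ varsT (sub s t)
    vars-sub⁺ s (var z)   x .z (here refl) x∈ = x∈
    vars-sub⁺ s (fn c ts) x z  z∈          x∈ = vars-subs⁺ s ts x z z∈ x∈

    vars-subs⁺ : ∀ s ts x z → z ∈ varsTs ts → x ∈ varsT (s z) → x ∈ varsTs (subs s ts)
    vars-subs⁺ s (t ∷ ts) x z z∈ x∈ with ∈-++⁻ (varsT t) z∈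
    ... | inj₁ m₁ = ∈-++⁺ˡ (vars-sub⁺ s t x z m₁ x∈)
    ... | inj₂ m₂ = ∈-++⁺ʳ (varsT (sub s t)) (vars-subs⁺ s ts x z m₂ x∈)

  vars-subA⁺ : ∀ s A x z → z ∈ varsA A → x ∈ varsT (s z) → x ∈ varsA (subA s A)
  vars-subA⁺ s (p ⟨ ts ⟩) = vars-subs⁺ s ts

  vars-subG⁺ : ∀ s G x z → z ∈ varsG G → x ∈ varsT (s z) → x ∈ varsG (subG s G)
  vars-subG⁺ s (A ∷ G) x z z∈ x∈ with ∈-++⁻ (varsA A) z∈
  ... | inj₁ m₁ = ∈-++⁺ˡ (vars-subA⁺ s A x z m₁ x∈)
  ... | inj₂ m₂ = ∈-++⁺ʳ (varsA (subA s A)) (vars-subG⁺ s G x z m₂ x∈)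

  vars-subC⁺ : ∀ s c x z → z ∈ varsC c → x ∈ varsT (s z) → x ∈ varsC (subC s c)
  vars-subC⁺ s (h ⇐ b) x z z∈ x∈ with ∈-++⁻ (varsA h) z∈
  ... | inj₁ m₁ = ∈-++⁺ˡ (vars-subA⁺ s h x z m₁ x∈)
  ... | inj₂ m₂ = ∈-++⁺ʳ (varsA (subA s h)) (vars-subG⁺ s b x z m₂ x∈)

  vars-renC : ∀ f c x → x ∈ varsC c → f x ∈ varsC (subC (ren f) c)
  vars-renC f c x x∈ = vars-subC⁺ (ren f) c (f x) x x∈ (here refl)

  varsG-++ : ∀ G H → varsG (G ++ H) ≡ varsG G ++ varsG H
  varsG-++ = concatMap-++ varsA

  varsG-++⁺ˡ : ∀ G H → varsG G ⊆ varsG (G ++ H)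
  varsG-++⁺ˡ G H x∈ = subst (_ ∈_) (sym (varsG-++ G H)) (∈-++⁺ˡ x∈)

  varsG-++⁺ʳ : ∀ G H → varsG H ⊆ varsG (G ++ H)
  varsG-++⁺ʳ G H x∈ = subst (_ ∈_) (sym (varsG-++ G H)) (∈-++⁺ʳ (varsG G) x∈)

  varsG-++-⊆ : ∀ G H {C} → varsG G ⊆ C → varsG H ⊆ C → varsG (G ++ H) ⊆ C
  varsG-++-⊆ G H G⊆C H⊆C x∈ with ∈-++⁻ (varsG G) (subst (_ ∈_) (varsG-++ G H) x∈)
  ... | inj₁ x∈G = G⊆C x∈G
  ... | inj₂ x∈H = H⊆C x∈H

  record Tracks (f : ℕ → ℕ) (C : List ℕ) (θ θ' : Subst) : Set where
    field
      onCore   : ∀ x → x ∈ C → app θ' (f x) ≡ sub (ren f) (app θ x)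
      closed   : ∀ x → x ∈ C → varsT (app θ x) ⊆ C
      offImage : ∀ y → OutsideImage f C y → app θ' y ≡ var y
      domain   : ∀ x → x ∈Dom θ → x ∈ C

    fixes : ∀ x → x ∉ C → app θ x ≡ var x
    fixes x x∉C with isVar? (app θ x) x
    ... | yes θx≡x = θx≡x
    ... | no  x∈dom = ⊥-elim (x∉C (domain x x∈dom))

    commute : ∀ t → varsT t ⊆ C → sub (app θ') (sub (ren f) t) ≡ sub (ren f) (sub (app θ) t)
    commute t t⊆C = begin
      sub (app θ') (sub (ren f) t)               ≡⟨ sub-comp (app θ') (ren f) t ⟩
      sub (λ x → app θ' (f x)) t                 ≡⟨ sub-cong t (λ x x∈ → onCore x (t⊆C x∈)) ⟩
      sub (λ x → sub (ren f) (app θ x)) t        ≡⟨ sub-comp (ren f) (app θ) t ⟨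
      sub (ren f) (sub (app θ) t)                ∎
      where open ≡-Reasoning

    commuteG : ∀ H → varsG H ⊆ C → subG (app θ') (subG (ren f) H) ≡ subG (ren f) (subG (app θ) H)
    commuteG H H⊆C = begin
      subG (app θ') (subG (ren f) H)             ≡⟨ subG-comp (app θ') (ren f) H ⟩
      subG (λ x → app θ' (f x)) H                ≡⟨ subG-cong H (λ x x∈ → onCore x (H⊆C x∈)) ⟩
      subG (λ x → sub (ren f) (app θ x)) H       ≡⟨ subG-comp (ren f) (app θ) H ⟨
      subG (ren f) (subG (app θ) H)              ∎
      where open ≡-Reasoning

    closedG : ∀ H → varsG H ⊆ C → varsG (subG (app θ) H) ⊆ C
    closedG H H⊆C {x} x∈ with vars-subG⁻ (app θ) H x x∈
    ... | z , z∈H , x∈θz = closed z (H⊆C z∈H) x∈θz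

  open Tracks

  tracks⇒variant : ∀ {f C θ θ'} → Tracks f C θ θ' → IsSubstVariant f θ θ'
  tracks⇒variant {f} {C} {θ} {θ'} T = (λ x x∈dom → onCore T x (domain T x x∈dom)) , fixed
    where
    fixed : ∀ y → (∀ x → x ∈Dom θ → f x ≢ y) → app θ' y ≡ var y
    fixed y notImage with isVar? (app θ' y) y
    ... | yes θ'y≡y = θ'y≡y
    ... | no  θ'y≢y = offImage T y y∉image
      where
      y∉image : OutsideImage f C y
      y∉image x x∈C refl with isVar? (app θ x) x
      ... | yes θx≡x  = θ'y≢y (trans (onCore T x x∈C) (cong (sub (ren f)) θx≡x))
      ... | no  x∈dom = notImage x x∈dom refl

  tracks-id : ∀ f C → Tracks f C idS idS
  tracks-id f C = record
    { onCore   = λ _ _ → refl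
    ; closed   = λ { x x∈C (here refl) → x∈C }
    ; offImage = λ _ _ → refl
    ; domain   = λ x x∈dom → ⊥-elim (x∈dom refl) }

  -- Tracking survives enlarging the core along an injective extension g of f:
  -- outside the old core θ is the identity, and g x lies outside f's old image.
  tracks-widen : ∀ {f g C D θ θ'} → Tracks f C θ θ' → C ⊆ D →
    (∀ x → x ∈ C → g x ≡ f x) → InjectiveOn g D → Tracks g D θ θ'
  tracks-widen {f} {g} {C} {D} {θ} {θ'} T C⊆D g≡f injD = record
    { onCore   = onCore′
    ; closed   = closed′
    ; offImage = λ y outD → offImage T y (λ x x∈C fx≡y → outD x (C⊆D x∈C) (trans (g≡f x x∈C) fx≡y))
    ; domain   = λ x x∈dom → C⊆D (domain T x x∈dom) }
    where
    onCore′ : ∀ x → x ∈ D → app θ' (g x) ≡ sub (ren g) (app θ x)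
    onCore′ x x∈D with x ∈? C
    ... | yes x∈C = trans (cong (app θ') (g≡f x x∈C))
                      (trans (onCore T x x∈C)
                        (sub-cong (app θ x) (λ z z∈ → cong var (sym (g≡f z (closed T x x∈C z∈))))))
    ... | no x∉C rewrite fixes T x x∉C = offImage T (g x) gx∉image
      where
      gx∉image : OutsideImage f C (g x)
      gx∉image z z∈C fz≡gx =
        x∉C (subst (_∈ C) (injD z x (C⊆D z∈C) x∈D (trans (g≡f z z∈C) fz≡gx)) z∈C)

    closed′ : ∀ x → x ∈ D → varsT (app θ x) ⊆ D
    closed′ x x∈D with x ∈? C
    ... | yes x∈C = λ z∈ → C⊆D (closed T x x∈C z∈)
    ... | no x∉C rewrite fixes T x x∉C = λ { (here refl) → x∈D }

  tracks-∘ : ∀ {f C θ θ' τ τ'} → Tracks f C θ θ' → Tracks f C τ τ' →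
    Tracks f C (τ ∘S θ) (τ' ∘S θ')
  tracks-∘ {f} {C} {θ} {θ'} {τ} {τ'} Tθ Tτ = record
    { onCore   = λ x x∈C → trans (cong (sub (app τ')) (onCore Tθ x x∈C))
                                 (commute Tτ (app θ x) (closed Tθ x x∈C))
    ; closed   = closed′
    ; offImage = λ y out → trans (cong (sub (app τ')) (offImage Tθ y out)) (offImage Tτ y out)
    ; domain   = domain′ }
    where
    closed′ : ∀ x → x ∈ C → varsT (sub (app τ) (app θ x)) ⊆ C
    closed′ x x∈C {z} z∈ with vars-sub⁻ (app τ) (app θ x) z z∈
    ... | w , w∈θx , z∈τw = closed Tτ w (closed Tθ x x∈C w∈θx) z∈τw

    domain′ : ∀ x → x ∈Dom (τ ∘S θ) → x ∈ C
    domain′ x x∈dom with isVar? (app θ x) x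
    ... | no  x∈domθ = domain Tθ x x∈domθ
    ... | yes θx≡x   = domain Tτ x (λ τx≡x → x∈dom (trans (cong (sub (app τ)) θx≡x) τx≡x))

  ⊕-left : ∀ a b x → x ∈ core a → fun (a ⊕ b) x ≡ fun a x
  ⊕-left a b x x∈a with x ∈? core a
  ... | yes _   = refl
  ... | no x∉a = ⊥-elim (x∉a x∈a)

  ⊕-right : ∀ a b x → x ∉ core a → fun (a ⊕ b) x ≡ fun b x
  ⊕-right a b x x∉a with x ∈? core a
  ... | yes x∈a = ⊥-elim (x∉a x∈a)
  ... | no _    = refl

  ⊕-injective : ∀ a b → InjectiveOn (fun a) (core a) → InjectiveOn (fun b) (core b) →
    (∀ x → x ∈ core b → x ∉ core a) →
    (∀ x y → x ∈ core a → y ∈ core b → fun a x ≢ fun b y) →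
    InjectiveOn (fun (a ⊕ b)) (core (a ⊕ b))
  ⊕-injective a b injA injB disjoint clash x y x∈ y∈ e
    with ∈-++⁻ (core a) x∈ | ∈-++⁻ (core a) y∈
  ... | inj₁ x∈a | inj₁ y∈a =
    injA x y x∈a y∈a (trans (sym (⊕-left a b x x∈a)) (trans e (⊕-left a b y y∈a)))
  ... | inj₂ x∈b | inj₂ y∈b =
    injB x y x∈b y∈b (trans (sym (⊕-right a b x (disjoint x x∈b)))
                            (trans e (⊕-right a b y (disjoint y y∈b))))
  ... | inj₁ x∈a | inj₂ y∈b =
    ⊥-elim (clash x y x∈a y∈b (trans (sym (⊕-left a b x x∈a))
                                     (trans e (⊕-right a b y (disjoint y y∈b)))))
  ... | inj₂ x∈b | inj₁ y∈a =
    ⊥-elim (clash y x y∈a x∈b (trans (sym (⊕-left a b y y∈a))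
                                     (trans (sym e) (⊕-right a b x (disjoint x x∈b)))))

  module Unification (U : UnifAlg) (isU : IsUnificationAlgorithm U)
                     (compatible : RenamingCompatible U) (relevant : RelevantMgus U) where

    renamed-mgu-tracks : ∀ {f C A B θ θ'} → InjectiveOn f C → varsA A ++ varsA B ⊆ C →
      U A B ≡ just θ → U (subA (ren f) A) (subA (ren f) B) ≡ just θ' → Tracks f C θ θ'
    renamed-mgu-tracks {f} {C} {A} {B} {θ} {θ'} injC AB⊆C U≡θ U≡θ' = record
      { onCore   = onCore′
      ; closed   = closed′
      ; offImage = offImage′
      ; domain   = λ x x∈dom → relevantC x (inj₁ x∈dom) }
      where
      A⊆C : varsA A ⊆ C
      A⊆C x∈ = AB⊆C (∈-++⁺ˡ x∈)

      B⊆C : varsA B ⊆ C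
      B⊆C x∈ = AB⊆C (∈-++⁺ʳ (varsA A) x∈)

      -- a renaming ρ agreeing with f on C, under which θ' is the variant of θ
      ρ : Renaming
      ρ = proj₁ (extend-to-renaming C f injC)
      ρ≡f : ∀ x → x ∈ C → rfun ρ x ≡ f x
      ρ≡f = proj₂ (extend-to-renaming C f injC)

      ρ≡f-on : ∀ A′ → varsA A′ ⊆ C → subA (ren (rfun ρ)) A′ ≡ subA (ren f) A′
      ρ≡f-on A′ A′⊆C = subA-cong A′ (λ x x∈ → cong var (ρ≡f x (A′⊆C x∈)))

      variantρ : IsSubstVariant (rfun ρ) θ θ'
      variantρ with compatible ρ A B (θ , proj₁ (proj₁ isU A B θ U≡θ)) θ U≡θ
      ... | τ , U≡τ , variantτ = subst (IsSubstVariant (rfun ρ) θ) τ≡θ' variantτ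
        where
        τ≡θ' : τ ≡ θ'
        τ≡θ' = just-injective (trans (sym U≡τ)
                 (trans (cong₂ U (ρ≡f-on A A⊆C) (ρ≡f-on B B⊆C))
                        U≡θ'))

      relevantC : ∀ x → x ∈VarsS θ → x ∈ C
      relevantC x x∈ = AB⊆C (relevant A B θ U≡θ x x∈)

      onCore′ : ∀ x → x ∈ C → app θ' (f x) ≡ sub (ren f) (app θ x)
      onCore′ x x∈C with isVar? (app θ x) x
      ... | no x∈dom = begin
        app θ' (f x)                  ≡⟨ cong (app θ') (ρ≡f x x∈C) ⟨
        app θ' (rfun ρ x)             ≡⟨ proj₁ variantρ x x∈dom ⟩
        sub (ren (rfun ρ)) (app θ x)  ≡⟨ sub-cong (app θ x) (λ z z∈ → cong var (ρ≡f z (θx⊆C z∈))) ⟩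
        sub (ren f) (app θ x)         ∎
        where
        open ≡-Reasoning
        θx⊆C : varsT (app θ x) ⊆ C
        θx⊆C {z} z∈ = relevantC z (inj₂ (x , x∈dom , z∈))
      ... | yes θx≡x rewrite θx≡x = proj₂ variantρ (f x) notImage
        where
        notImage : ∀ x′ → x′ ∈Dom θ → rfun ρ x′ ≢ f x
        notImage x′ x′∈dom ρx′≡fx = x′∈dom (subst (λ w → app θ w ≡ var w) (sym x′≡x) θx≡x)
          where
          x′∈C : x′ ∈ C
          x′∈C = relevantC x′ (inj₁ x′∈dom)
          x′≡x : x′ ≡ x
          x′≡x = injC x′ x x′∈C x∈C (trans (sym (ρ≡f x′ x′∈C)) ρx′≡fx)

      closed′ : ∀ x → x ∈ C → varsT (app θ x) ⊆ C
      closed′ x x∈C {z} z∈ with isVar? (app θ x) x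
      ... | no x∈dom = relevantC z (inj₂ (x , x∈dom , z∈))
      ... | yes θx≡x rewrite θx≡x with z∈
      ... | here refl = x∈C

      inImage : ∀ A′ → varsA A′ ⊆ C → ∀ y → y ∈ varsA (subA (ren f) A′) → ¬ OutsideImage f C y
      inImage A′ A′⊆C y y∈ notImage with vars-subA⁻ (ren f) A′ y y∈
      ... | z , z∈ , here refl = notImage z (A′⊆C z∈) refl

      -- by relevance, a variable moved by θ' occurs in the renamed equation
      offImage′ : ∀ y → OutsideImage f C y → app θ' y ≡ var y
      offImage′ y notImage with isVar? (app θ' y) y
      ... | yes θ'y≡y = θ'y≡y
      ... | no  y∈dom with ∈-++⁻ (varsA (subA (ren f) A)) (relevant _ _ θ' U≡θ' y (inj₁ y∈dom))
      ... | inj₁ y∈fA = ⊥-elim (inImage A A⊆C y y∈fA notImage)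
      ... | inj₂ y∈fB = ⊥-elim (inImage B B⊆C y y∈fB notImage)

  EarlierVar : (ℕ → Goal) → (ℕ → Clause) → ℕ → ℕ → Set
  EarlierVar G K m x = x ∈ varsG (G 0) ⊎ ∃ λ j → 1 ≤ j × j ≤ m × x ∈ varsC (K j)

  earlier-suc : ∀ G K {m x} → EarlierVar G K m x → EarlierVar G K (suc m) x
  earlier-suc G K (inj₁ x∈G₀)                 = inj₁ x∈G₀
  earlier-suc G K (inj₂ (j , 1≤j , j≤m , x∈)) = inj₂ (j , 1≤j , m≤n⇒m≤1+n j≤m , x∈)

  input-fresh : ∀ {P U n G pos K σ} → SLDDerivation P U n G pos K σ →
    ∀ m → suc m ≤ n → ∀ x → x ∈ varsC (K (suc m)) → ¬ EarlierVar G K m x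
  input-fresh d m h x x∈ (inj₁ x∈G₀) =
    proj₁ (SLDDerivation.apart d m h x x∈) 0 z≤n x∈G₀
  input-fresh d m h x x∈ (inj₂ (j , 1≤j , j≤m , x∈Kj)) =
    proj₁ (proj₂ (SLDDerivation.apart d m h x x∈) j 1≤j j≤m) x∈Kj

  module Derivations
      (U : UnifAlg) (isU : IsUnificationAlgorithm U)
      (compatible : RenamingCompatible U) (relevant : RelevantMgus U)
      (P : List Clause) (n : ℕ)
      (G G' : ℕ → Goal) (pos pos' : ℕ → ℕ) (K K' : ℕ → Clause) (σ σ' : ℕ → Subst)
      (d : SLDDerivation P U n G pos K σ) (d' : SLDDerivation P U n G' pos' K' σ')
      (similar : Similar n G pos K G' pos' K') (α : PreRen) (lam : ℕ → PreRen)
      (prenα : IsPrenG α (G 0) (G' 0))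
      (prenλ : ∀ i → 1 ≤ i → i ≤ n → IsPrenC (lam i) (K i) (K' i)) where

    open Unification U isU compatible relevant

    f : ℕ → ℕ → ℕ
    f i = fun (βsum α lam i)

    C : ℕ → List ℕ
    C i = core (βsum α lam i)

    input-core : ∀ m → suc m ≤ n → ∀ x → (x ∈ core (lam (suc m))) ⇔ (x ∈ varsC (K (suc m)))
    input-core m h = proj₁ (proj₂ (prenλ (suc m) (s≤s z≤n) h))

    input-renamed-λ : ∀ m → suc m ≤ n → K' (suc m) ≡ subC (ren (fun (lam (suc m)))) (K (suc m))
    input-renamed-λ m h = proj₂ (proj₂ (prenλ (suc m) (s≤s z≤n) h))

    core-earlier : ∀ m → m ≤ n → ∀ x → x ∈ C m → EarlierVar G K m x
    core-earlier zero    h x x∈ = inj₁ (Equivalence.to (proj₁ (proj₂ prenα) x) x∈)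
    core-earlier (suc m) h x x∈ with ∈-++⁻ (C m) x∈
    ... | inj₁ x∈old = earlier-suc G K (core-earlier m (<⇒≤ h) x x∈old)
    ... | inj₂ x∈new = inj₂ (suc m , s≤s z≤n , ≤-refl , Equivalence.to (input-core m h x) x∈new)

    core-disjoint : ∀ m → suc m ≤ n → ∀ x → x ∈ core (lam (suc m)) → x ∉ C m
    core-disjoint m h x x∈new x∈old =
      input-fresh d m h x (Equivalence.to (input-core m h x) x∈new) (core-earlier m (<⇒≤ h) x x∈old)

    β-old : ∀ m x → x ∈ C m → f (suc m) x ≡ f m x
    β-old m = ⊕-left (βsum α lam m) (lam (suc m))

    β-new : ∀ m → suc m ≤ n → ∀ x → x ∈ core (lam (suc m)) → f (suc m) x ≡ fun (lam (suc m)) x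
    β-new m h x x∈new = ⊕-right (βsum α lam m) (lam (suc m)) x (core-disjoint m h x x∈new)

    input-image : ∀ m → suc m ≤ n → ∀ y → y ∈ core (lam (suc m)) →
      fun (lam (suc m)) y ∈ varsC (K' (suc m))
    input-image m h y y∈ = subst (λ c → fun (lam (suc m)) y ∈ varsC c) (sym (input-renamed-λ m h))
      (vars-renC (fun (lam (suc m))) (K (suc m)) y (Equivalence.to (input-core m h y) y∈))

    image-earlier : ∀ m → m ≤ n → ∀ x → x ∈ C m → EarlierVar G' K' m (f m x)
    image-earlier zero h x x∈ rewrite proj₂ (proj₂ prenα) =
      inj₁ (vars-subG⁺ (ren (fun α)) (G 0) (fun α x) x (Equivalence.to (proj₁ (proj₂ prenα) x) x∈) (here refl))
    image-earlier (suc m) h x x∈ with ∈-++⁻ (C m) x∈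
    ... | inj₁ x∈old rewrite β-old m x x∈old = earlier-suc G' K' (image-earlier m (<⇒≤ h) x x∈old)
    ... | inj₂ x∈new rewrite β-new m h x x∈new =
      inj₂ (suc m , s≤s z≤n , ≤-refl , input-image m h x x∈new)

    image-disjoint : ∀ m → suc m ≤ n → ∀ x y → x ∈ C m → y ∈ core (lam (suc m)) →
      f m x ≢ fun (lam (suc m)) y
    image-disjoint m h x y x∈old y∈new fx≡λy =
      input-fresh d' m h (fun (lam (suc m)) y) (input-image m h y y∈new)
        (subst (EarlierVar G' K' m) fx≡λy (image-earlier m (<⇒≤ h) x x∈old))

    -- Both freshness facts together make every β m a prenaming on its core.
    β-injective : ∀ m → m ≤ n → InjectiveOn (f m) (C m)
    β-injective zero    h = proj₂ (proj₁ prenα)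
    β-injective (suc m) h =
      ⊕-injective (βsum α lam m) (lam (suc m)) (β-injective m (<⇒≤ h))
        (proj₂ (proj₁ (prenλ (suc m) (s≤s z≤n) h))) (core-disjoint m h) (image-disjoint m h)

    record Invariant (m : ℕ) : Set where
      field
        goal     : G' m ≡ subG (ren (f m)) (G m)
        goalVars : varsG (G m) ⊆ C m
        answers  : Tracks (f m) (C m) (answer σ m) (answer σ' m)

    invariant-0 : Invariant 0
    invariant-0 = record
      { goal     = proj₂ (proj₂ prenα)
      ; goalVars = λ {x} x∈ → Equivalence.from (proj₁ (proj₂ prenα) x) x∈
      ; answers  = tracks-id (f 0) (C 0) }

    module Step (m : ℕ) (h : suc m ≤ n) (I : Invariant m) where
      open Invariant I
      module S  = SLDStep (SLDDerivation.steps d m h)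
      module S' = SLDStep (SLDDerivation.steps d' m h)

      selected : S'.M ≡ subG (ren (f m)) S.M × S'.A ≡ subA (ren (f m)) S.A × S'.N ≡ subG (ren (f m)) S.N
      selected = ++-∷-injective S'.M (subG (ren (f m)) S.M) sameLength sameGoal
        where
        sameLength : length S'.M ≡ length (subG (ren (f m)) S.M)
        sameLength = begin
          length S'.M                     ≡⟨ S'.posn ⟩
          pos' (suc m)                    ≡⟨ proj₁ (proj₂ similar (suc m) (s≤s z≤n) h) ⟨
          pos (suc m)                     ≡⟨ S.posn ⟨
          length S.M                      ≡⟨ length-map (subA (ren (f m))) S.M ⟨
          length (subG (ren (f m)) S.M)   ∎
          where open ≡-Reasoning
        sameGoal : S'.M ++ S'.A ∷ S'.N ≡ subG (ren (f m)) S.M ++ subA (ren (f m)) S.A ∷ subG (ren (f m)) S.N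
        sameGoal = begin
          S'.M ++ S'.A ∷ S'.N                     ≡⟨ S'.split ⟨
          G' m                                    ≡⟨ goal ⟩
          subG (ren (f m)) (G m)                  ≡⟨ cong (subG (ren (f m))) S.split ⟩
          subG (ren (f m)) (S.M ++ S.A ∷ S.N)     ≡⟨ map-++ (subA (ren (f m))) S.M (S.A ∷ S.N) ⟩
          subG (ren (f m)) S.M ++ subA (ren (f m)) S.A ∷ subG (ren (f m)) S.N ∎
          where open ≡-Reasoning

      selectedVars : varsG (S.M ++ S.A ∷ S.N) ⊆ C m
      selectedVars x∈ = goalVars (subst (λ g → _ ∈ varsG g) (sym S.split) x∈)

      M⊆ : varsG S.M ⊆ C m
      M⊆ x∈ = selectedVars (varsG-++⁺ˡ S.M (S.A ∷ S.N) x∈)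

      A⊆ : varsA S.A ⊆ C m
      A⊆ x∈ = selectedVars (varsG-++⁺ʳ S.M (S.A ∷ S.N) (∈-++⁺ˡ x∈))

      N⊆ : varsG S.N ⊆ C m
      N⊆ x∈ = selectedVars (varsG-++⁺ʳ S.M (S.A ∷ S.N) (∈-++⁺ʳ (varsA S.A) x∈))

      old⊆ : C m ⊆ C (suc m)
      old⊆ = ∈-++⁺ˡ

      input⊆ : varsC (K (suc m)) ⊆ C (suc m)
      input⊆ {x} x∈ = ∈-++⁺ʳ (C m) (Equivalence.from (input-core m h x) x∈)

      renamed-old : ∀ H → varsG H ⊆ C m → subG (ren (f m)) H ≡ subG (ren (f (suc m))) H
      renamed-old H H⊆ = subG-cong H (λ x x∈ → cong var (sym (β-old m x (H⊆ x∈))))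

      selected-renamed : S'.A ≡ subA (ren (f (suc m))) S.A
      selected-renamed = trans (proj₁ (proj₂ selected))
                           (subA-cong S.A (λ x x∈ → cong var (sym (β-old m x (A⊆ x∈)))))

      input-renamed : K' (suc m) ≡ subC (ren (f (suc m))) (K (suc m))
      input-renamed = trans (input-renamed-λ m h) (subC-cong (K (suc m)) λ x x∈ →
        cong var (sym (β-new m h x (Equivalence.from (input-core m h x) x∈))))

      resolvent resolvent' : Goal
      resolvent  = S.M ++ body (K (suc m)) ++ S.N
      resolvent' = S'.M ++ body (K' (suc m)) ++ S'.N

      resolvent-vars : varsG resolvent ⊆ C (suc m)
      resolvent-vars =
        varsG-++-⊆ S.M _ (⊆-trans M⊆ old⊆)
          (varsG-++-⊆ (body (K (suc m))) S.N (λ x∈ → input⊆ (∈-++⁺ʳ _ x∈)) (⊆-trans N⊆ old⊆))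

      resolvent-renamed : resolvent' ≡ subG (ren (f (suc m))) resolvent
      resolvent-renamed = begin
        S'.M ++ body (K' (suc m)) ++ S'.N
          ≡⟨ cong₂ _++_ (trans (proj₁ selected) (renamed-old S.M M⊆))
               (cong₂ _++_ (cong body input-renamed) (trans (proj₂ (proj₂ selected)) (renamed-old S.N N⊆))) ⟩
        subG fᵢ S.M ++ subG fᵢ (body (K (suc m))) ++ subG fᵢ S.N
          ≡⟨ cong (subG fᵢ S.M ++_) (map-++ (subA fᵢ) (body (K (suc m))) S.N) ⟨
        subG fᵢ S.M ++ subG fᵢ (body (K (suc m)) ++ S.N)
          ≡⟨ map-++ (subA fᵢ) S.M (body (K (suc m)) ++ S.N) ⟨
        subG fᵢ resolvent ∎
        where
        open ≡-Reasoning
        fᵢ : ℕ → Term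
        fᵢ = ren (f (suc m))

      unifier-tracks : Tracks (f (suc m)) (C (suc m)) (σ (suc m)) (σ' (suc m))
      unifier-tracks = renamed-mgu-tracks (β-injective (suc m) h) equation⊆ S.mgu
        (subst₂ (λ a c → U a (head c) ≡ just (σ' (suc m))) selected-renamed input-renamed S'.mgu)
        where
        equation⊆ : varsA S.A ++ varsA (head (K (suc m))) ⊆ C (suc m)
        equation⊆ x∈ with ∈-++⁻ (varsA S.A) x∈
        ... | inj₁ x∈A = old⊆ (A⊆ x∈A)
        ... | inj₂ x∈H = input⊆ (∈-++⁺ˡ x∈H)

      -- the goal is transported through the tracked mgu, and the old answer is
      -- widened to the new core before composing with the new mgu
      next : Invariant (suc m)
      next = record
        { goal     = goal′
        ; goalVars = λ x∈ → closedG unifier-tracks resolvent resolvent-vars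
                              (subst (λ g → _ ∈ varsG g) S.result x∈)
        ; answers  = tracks-∘ (tracks-widen answers old⊆ (β-old m) (β-injective (suc m) h)) unifier-tracks }
        where
        goal′ : G' (suc m) ≡ subG (ren (f (suc m))) (G (suc m))
        goal′ = begin
          G' (suc m)                                                    ≡⟨ S'.result ⟩
          subG (app (σ' (suc m))) resolvent'                            ≡⟨ cong (subG (app (σ' (suc m)))) resolvent-renamed ⟩
          subG (app (σ' (suc m))) (subG (ren (f (suc m))) resolvent)    ≡⟨ commuteG unifier-tracks resolvent resolvent-vars ⟩
          subG (ren (f (suc m))) (subG (app (σ (suc m))) resolvent)     ≡⟨ cong (subG (ren (f (suc m)))) S.result ⟨
          subG (ren (f (suc m))) (G (suc m))                            ∎
          where open ≡-Reasoning

    invariant : ∀ m → m ≤ n → Invariant m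
    invariant zero    _ = invariant-0
    invariant (suc m) h = Step.next m h (invariant m (<⇒≤ h))

-- By the invariant after m steps, step m+1 has β (m+1)-variant goal, mgu and
-- partial answer.
mainTheorem1 : (F Pr : Set) → let open Syntax F Pr in
    (U : UnifAlg) → IsUnificationAlgorithm U → RenamingCompatible U → RelevantMgus U →
    (P : List Clause) (n : ℕ)
    (G G' : ℕ → Goal) (pos pos' : ℕ → ℕ) (K K' : ℕ → Clause) (σ σ' : ℕ → Subst) →
    SLDDerivation P U n G pos K σ →
    SLDDerivation P U n G' pos' K' σ' →
    Similar n G pos K G' pos' K' →
    (α : PreRen) (lam : ℕ → PreRen) →
    IsPrenG α (G 0) (G' 0) →
    (∀ i → 1 ≤ i → i ≤ n → IsPrenC (lam i) (K i) (K' i)) →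
    ∀ i → 1 ≤ i → i ≤ n →
    (G' i ≡ subG (ren (fun (βsum α lam i))) (G i)) ×
    IsSubstVariant (fun (βsum α lam i)) (σ i) (σ' i) ×
    IsSubstVariant (fun (βsum α lam i)) (answer σ i) (answer σ' i)
mainTheorem1 F Pr U isU compatible relevant P n G G' pos pos' K K' σ σ' d d' similar α lam prenα prenλ
  (suc m) _ h =
  Invariant.goal next , tracks⇒variant unifier-tracks , tracks⇒variant (Invariant.answers next)
  where
  open Development F Pr
  open Derivations U isU compatible relevant P n G G' pos pos' K K' σ σ' d d' similar α lam prenα prenλ
  open Step m h (invariant m (<⇒≤ h))
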